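{- Let $d\ge 7$ be an integer and let $k$ be an integer with $0\le k\le \lfloor (d+1)/2\rfloor-2$. If $C^d_{d-3,k}\le 0$, then $C^d_{d-3,k+1}\ge C^d_{d-3,k}$; and if $C^d_{d-3,k}\ge 0$, then $C^d_{d-3,k+1}\ge 0$.
   Context: For integers $i$ and $d$, let $c_i(z)=(z+i)(z+i-1)\cdots(z+i-(d-1))=d!\binom{z+i}{d}$, and let $C^d_{r,i}$ denote the coefficient of $z^r$ in $c_i(z)$, $0\le r\le d$. -}

module Defs where

open import Data.Nat using (ℕ; zero; suc)
open import Data.Integer using (ℤ; +_; _+_; _*_; _-_; 0ℤ; 1ℤ)
open import Data.List using (List; []; _∷_)

-- Polynomials over ℤ as coefficient lists, lowest degree first.

mulLinear : ℤ → List ℤ → List ℤ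
mulLinear a p = go 0ℤ p
  where
  -- prev = coefficient of degree r-1 of p (0 at r = 0)
  go : ℤ → List ℤ → List ℤ
  go prev []       = prev ∷ []
  go prev (x ∷ xs) = (a * x + prev) ∷ go x xs

fallingProd : ℤ → ℕ → List ℤ
fallingProd i zero    = 1ℤ ∷ []
fallingProd i (suc m) = mulLinear (i - + m) (fallingProd i m)

c : ℕ → ℤ → List ℤ
c d i = fallingProd i d

-- coefficient of z^r in a coefficient list (0 beyond the length)
coeff : List ℤ → ℕ → ℤ
coeff []       _       = 0ℤ
coeff (x ∷ _)  zero    = x
coeff (_ ∷ xs) (suc r) = coeff xs r

C : ℕ → ℕ → ℤ → ℤ
C d r i = coeff (c d i) r

module Submission where

-- The coefficient C^d_{d-3,i} of c_i(z) = ∏_{j<d} (z + i - j) is the third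
-- elementary symmetric function e₃ of the roots i, i-1, …, i-d+1.
--
-- 1. For an arbitrary root sequence a, the coefficient of z^s in
--    ∏_{j<r+s} (z + a j) is e_r(a 0, …, a (r+s-1))   (linProd-coeff).
-- 2. For the falling roots a j = i - j, telescoping gives closed forms for
--    e₁, e₂, e₃; with d = n + 3 and u = n + 2 - 2i this yields
--        48 · C^d_{d-3,i} = (n+3)(n+2)(n+1) · u((n+4) - u²).
-- 3. Write n = 2k + t (t ≥ 0 by the bound on k).  Then i = k and i = k+1
--    correspond to u = t + 2 and u = t, and the claim reduces to two facts
--    about the cubic g(u) = u(b - u²) with t ≥ 0:
--        g(t+2) ≥ 0 ⇒ g(t) ≥ 0   and   g(t+2) ≤ 0 ⇒ g(t+2) ≤ g(t),
--    both because g(t) - g(t+2) = 2((t+2)² - b) + 4t(t+1) and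
--    t² < (t+2)².  Comparisons transfer along the positive scale factors.

open import Defs
open import Data.Nat using (ℕ; zero; suc; _∸_; _≤_; _<_; _/_; s≤s; z≤n)
  renaming (_+_ to _ℕ+_; _*_ to _ℕ*_)
import Data.Nat.Properties as ℕ
open import Data.Nat.DivMod using (m/n*n≤m)
open import Data.Integer using (ℤ; +_; _+_; _*_; _-_; -_; 0ℤ; 1ℤ; +≤+; Positive; NonNegative; nonNegative)
  renaming (_≤_ to _≤ℤ_)
open import Data.Integer.Properties
  using (*-zeroʳ; +-identityˡ; +-comm; pos-*; +-mono-≤; *-monoˡ-≤-nonNeg; *-cancelˡ-≤-pos; neg-mono-≤; 0≤i-j⇒j≤i)
open import Data.Integer.Tactic.RingSolver using (solve-∀)
open import Data.List using (List; []; _∷_)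
open import Data.Product using (_×_; _,_)
open import Relation.Binary.PropositionalEquality
open ≡-Reasoning

absorb : ∀ a b → a * 0ℤ + b ≡ b
absorb a b = trans (cong (_+ b) (*-zeroʳ a)) (+-identityˡ b)

mulLinear-coeff : ∀ a p r → coeff (mulLinear a p) r ≡ a * coeff p r + coeff (0ℤ ∷ p) r
mulLinear-coeff a []           zero          = sym (absorb a 0ℤ)
mulLinear-coeff a []           (suc r)       = sym (absorb a 0ℤ)
mulLinear-coeff a (x ∷ xs)     zero          = refl
mulLinear-coeff a (x ∷ [])     (suc zero)    = sym (absorb a x)
mulLinear-coeff a (x ∷ [])     (suc (suc r)) = sym (absorb a 0ℤ)
mulLinear-coeff a (x ∷ y ∷ ys) (suc zero)    = refl
-- past the first entry, mulLinear a (x ∷ y ∷ ys) runs the same loop as mulLinear a (y ∷ ys)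
mulLinear-coeff a (x ∷ y ∷ ys) (suc (suc r)) = mulLinear-coeff a (y ∷ ys) (suc r)

-- ∏_{j<m} (z + a j), multiplied out in the same order as fallingProd.
linProd : (ℕ → ℤ) → ℕ → List ℤ
linProd a zero    = 1ℤ ∷ []
linProd a (suc m) = mulLinear (a m) (linProd a m)

linProd-step : ∀ a m s →
  coeff (linProd a (suc m)) (suc s) ≡ a m * coeff (linProd a m) (suc s) + coeff (linProd a m) s
linProd-step a m s = mulLinear-coeff (a m) (linProd a m) (suc s)

linProd-high : ∀ a m s → m < s → coeff (linProd a m) s ≡ 0ℤ
linProd-high a zero    (suc s) _         = refl
linProd-high a (suc m) (suc s) (s≤s m<s) = begin
  coeff (linProd a (suc m)) (suc s)
    ≡⟨ linProd-step a m s ⟩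
  a m * coeff (linProd a m) (suc s) + coeff (linProd a m) s
    ≡⟨ cong₂ (λ u v → a m * u + v) (linProd-high a m (suc s) (ℕ.m<n⇒m<1+n m<s)) (linProd-high a m s m<s) ⟩
  a m * 0ℤ + 0ℤ
    ≡⟨ absorb (a m) 0ℤ ⟩
  0ℤ ∎

esym : (ℕ → ℤ) → ℕ → ℕ → ℤ
esym a zero    m       = 1ℤ
esym a (suc r) zero    = 0ℤ
esym a (suc r) (suc m) = esym a (suc r) m + a m * esym a r m

esym-high : ∀ a m r → m < r → esym a r m ≡ 0ℤ
esym-high a zero    (suc r) _         = refl
esym-high a (suc m) (suc r) (s≤s m<r) = begin
  esym a (suc r) m + a m * esym a r m
    ≡⟨ cong₂ (λ u v → u + a m * v) (esym-high a m (suc r) (ℕ.m<n⇒m<1+n m<r)) (esym-high a m r m<r) ⟩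
  0ℤ + a m * 0ℤ
    ≡⟨ +-comm 0ℤ (a m * 0ℤ) ⟩
  a m * 0ℤ + 0ℤ
    ≡⟨ absorb (a m) 0ℤ ⟩
  0ℤ ∎

linProd-coeff : ∀ a r s → coeff (linProd a (r ℕ+ s)) s ≡ esym a r (r ℕ+ s)
linProd-coeff a zero    zero    = refl
linProd-coeff a zero    (suc s) = begin
  coeff (linProd a (suc s)) (suc s)
    ≡⟨ linProd-step a s s ⟩
  a s * coeff (linProd a s) (suc s) + coeff (linProd a s) s
    ≡⟨ cong₂ (λ u v → a s * u + v) (linProd-high a s (suc s) (ℕ.n<1+n s)) (linProd-coeff a zero s) ⟩
  a s * 0ℤ + 1ℤ
    ≡⟨ absorb (a s) 1ℤ ⟩
  1ℤ ∎
linProd-coeff a (suc r) zero    = begin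
  coeff (linProd a (suc m)) 0
    ≡⟨ mulLinear-coeff (a m) (linProd a m) 0 ⟩
  a m * coeff (linProd a m) 0 + 0ℤ
    ≡⟨ cong₂ (λ u v → a m * u + v) (linProd-coeff a r zero) (sym (esym-high a m (suc r) m<1+r)) ⟩
  a m * esym a r m + esym a (suc r) m
    ≡⟨ +-comm (a m * esym a r m) (esym a (suc r) m) ⟩
  esym a (suc r) m + a m * esym a r m ∎
  where
  m = r ℕ+ zero
  m<1+r : m < suc r
  m<1+r = s≤s (ℕ.≤-reflexive (ℕ.+-identityʳ r))
linProd-coeff a (suc r) (suc s) = begin
  coeff (linProd a (suc m)) (suc s)
    ≡⟨ linProd-step a m s ⟩
  a m * coeff (linProd a m) (suc s) + coeff (linProd a m) s
    ≡⟨ cong₂ (λ u v → a m * u + v) (linProd-coeff a r (suc s)) shifted ⟩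
  a m * esym a r m + esym a (suc r) m
    ≡⟨ +-comm (a m * esym a r m) (esym a (suc r) m) ⟩
  esym a (suc r) m + a m * esym a r m ∎
  where
  m = r ℕ+ suc s
  -- the inductive hypothesis at (r+1, s), reindexed along r + (s+1) = (r+1) + s
  shifted : coeff (linProd a m) s ≡ esym a (suc r) m
  shifted = subst (λ n → coeff (linProd a n) s ≡ esym a (suc r) n)
                  (sym (ℕ.+-suc r s)) (linProd-coeff a (suc r) s)

fallingRoot : ℤ → ℕ → ℤ
fallingRoot i j = i - + j

fallingProd-linProd : ∀ i m → fallingProd i m ≡ linProd (fallingRoot i) m
fallingProd-linProd i zero    = refl
fallingProd-linProd i (suc m) = cong (mulLinear (i - + m)) (fallingProd-linProd i m)

-- Twice the mean of the roots i, …, i-m+1 of fallingProd i m.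
centre : ℤ → ℤ → ℤ
centre i M = + 2 * i - M + 1ℤ

esym₁-falling : ∀ i m → + 2 * esym (fallingRoot i) 1 m ≡ + m * centre i (+ m)
esym₁-falling i zero    = refl
esym₁-falling i (suc m) = begin
  + 2 * (E + (i - M) * 1ℤ)       ≡⟨ distribute E i M ⟩
  + 2 * E + + 2 * (i - M)        ≡⟨ cong (_+ + 2 * (i - M)) (esym₁-falling i m) ⟩
  M * centre i M + + 2 * (i - M) ≡⟨ extend i M ⟩
  (1ℤ + M) * centre i (1ℤ + M)   ∎
  where
  M = + m
  E = esym (fallingRoot i) 1 m
  distribute : ∀ E i M → + 2 * (E + (i - M) * 1ℤ) ≡ + 2 * E + + 2 * (i - M)
  distribute = solve-∀
  extend : ∀ i M → M * (+ 2 * i - M + 1ℤ) + + 2 * (i - M)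
                 ≡ (1ℤ + M) * (+ 2 * i - (1ℤ + M) + 1ℤ)
  extend = solve-∀

esym₂-falling : ∀ i m → let M = + m; X = centre i M in
  + 24 * esym (fallingRoot i) 2 m ≡ M * (M - 1ℤ) * (+ 3 * (X * X) - (M + 1ℤ))
esym₂-falling i zero    = refl
esym₂-falling i (suc m) = begin
  + 24 * (E₂ + (i - M) * E₁)
    ≡⟨ distribute E₂ E₁ i M ⟩
  + 24 * E₂ + + 12 * (i - M) * (+ 2 * E₁)
    ≡⟨ cong₂ (λ u v → u + + 12 * (i - M) * v) (esym₂-falling i m) (esym₁-falling i m) ⟩
  M * (M - 1ℤ) * (+ 3 * (X * X) - (M + 1ℤ)) + + 12 * (i - M) * (M * X)
    ≡⟨ extend i M ⟩
  M′ * (M′ - 1ℤ) * (+ 3 * (X′ * X′) - (M′ + 1ℤ)) ∎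
  where
  M = + m
  X = centre i M
  M′ = 1ℤ + M
  X′ = centre i M′
  E₁ = esym (fallingRoot i) 1 m
  E₂ = esym (fallingRoot i) 2 m
  distribute : ∀ E₂ E₁ i M → + 24 * (E₂ + (i - M) * E₁) ≡ + 24 * E₂ + + 12 * (i - M) * (+ 2 * E₁)
  distribute = solve-∀
  extend : ∀ i M → let X = + 2 * i - M + 1ℤ; X′ = + 2 * i - (1ℤ + M) + 1ℤ in
    M * (M - 1ℤ) * (+ 3 * (X * X) - (M + 1ℤ)) + + 12 * (i - M) * (M * X)
      ≡ (1ℤ + M) * ((1ℤ + M) - 1ℤ) * (+ 3 * (X′ * X′) - ((1ℤ + M) + 1ℤ))
  extend = solve-∀

esym₃-falling : ∀ i m → let M = + m; X = centre i M in
  + 48 * esym (fallingRoot i) 3 m ≡ M * (M - 1ℤ) * (M - + 2) * X * (X * X - (M + 1ℤ))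
esym₃-falling i zero    = refl
esym₃-falling i (suc m) = begin
  + 48 * (E₃ + (i - M) * E₂)
    ≡⟨ distribute E₃ E₂ i M ⟩
  + 48 * E₃ + + 2 * (i - M) * (+ 24 * E₂)
    ≡⟨ cong₂ (λ u v → u + + 2 * (i - M) * v) (esym₃-falling i m) (esym₂-falling i m) ⟩
  M * (M - 1ℤ) * (M - + 2) * X * (X * X - (M + 1ℤ))
    + + 2 * (i - M) * (M * (M - 1ℤ) * (+ 3 * (X * X) - (M + 1ℤ)))
    ≡⟨ extend i M ⟩
  M′ * (M′ - 1ℤ) * (M′ - + 2) * X′ * (X′ * X′ - (M′ + 1ℤ)) ∎
  where
  M = + m
  X = centre i M
  M′ = 1ℤ + M
  X′ = centre i M′
  E₂ = esym (fallingRoot i) 2 m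
  E₃ = esym (fallingRoot i) 3 m
  distribute : ∀ E₃ E₂ i M → + 48 * (E₃ + (i - M) * E₂) ≡ + 48 * E₃ + + 2 * (i - M) * (+ 24 * E₂)
  distribute = solve-∀
  extend : ∀ i M → let X = + 2 * i - M + 1ℤ; X′ = + 2 * i - (1ℤ + M) + 1ℤ in
    M * (M - 1ℤ) * (M - + 2) * X * (X * X - (M + 1ℤ))
      + + 2 * (i - M) * (M * (M - 1ℤ) * (+ 3 * (X * X) - (M + 1ℤ)))
      ≡ (1ℤ + M) * ((1ℤ + M) - 1ℤ) * ((1ℤ + M) - + 2) * X′ * (X′ * X′ - ((1ℤ + M) + 1ℤ))
  extend = solve-∀

scale : ℕ → ℤ
scale n = (+ 3 + + n) * (+ 2 + + n) * (+ 1 + + n)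

cubic : ℤ → ℤ → ℤ
cubic b u = u * (b - u * u)

C-formula : ∀ n i → + 48 * C (3 ℕ+ n) n i ≡ scale n * cubic (+ 4 + + n) (+ 2 + + n - + 2 * i)
C-formula n i = begin
  + 48 * coeff (fallingProd i (3 ℕ+ n)) n
    ≡⟨ cong (λ p → + 48 * coeff p n) (fallingProd-linProd i (3 ℕ+ n)) ⟩
  + 48 * coeff (linProd (fallingRoot i) (3 ℕ+ n)) n
    ≡⟨ cong (+ 48 *_) (linProd-coeff (fallingRoot i) 3 n) ⟩
  + 48 * esym (fallingRoot i) 3 (3 ℕ+ n)
    ≡⟨ esym₃-falling i (3 ℕ+ n) ⟩
  M * (M - 1ℤ) * (M - + 2) * X * (X * X - (M + 1ℤ))
    ≡⟨ factor i (+ n) ⟩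
  scale n * cubic (+ 4 + + n) (+ 2 + + n - + 2 * i) ∎
  where
  M = + 3 + + n
  X = centre i M
  factor : ∀ i N → let M = + 3 + N; X = + 2 * i - M + 1ℤ; u = + 2 + N - + 2 * i in
    M * (M - 1ℤ) * (M - + 2) * X * (X * X - (M + 1ℤ))
      ≡ (+ 3 + N) * (+ 2 + N) * (+ 1 + N) * (u * ((+ 4 + N) - u * u))
  factor = solve-∀

0≤+ : ∀ n → 0ℤ ≤ℤ + n
0≤+ n = +≤+ z≤n

nonNeg-* : ∀ {a b} → 0ℤ ≤ℤ a → 0ℤ ≤ℤ b → 0ℤ ≤ℤ a * b
nonNeg-* {a} 0≤a 0≤b = subst (_≤ℤ a * _) (*-zeroʳ a) (*-monoˡ-≤-nonNeg a {{nonNegative 0≤a}} 0≤b)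

nonNeg-+ : ∀ {a b} → 0ℤ ≤ℤ a → 0ℤ ≤ℤ b → 0ℤ ≤ℤ a + b
nonNeg-+ {a} {b} = +-mono-≤ {0ℤ} {a} {0ℤ} {b}

positive-factor : ∀ p q .{{_ : Positive p}} → 0ℤ ≤ℤ p * q → 0ℤ ≤ℤ q
positive-factor p q 0≤pq = *-cancelˡ-≤-pos 0ℤ q p (subst (_≤ℤ p * q) (sym (*-zeroʳ p)) 0≤pq)

scaled-≤ : ∀ p q {x y a b} .{{_ : Positive p}} .{{_ : NonNegative q}} →
  p * x ≡ q * a → p * y ≡ q * b → a ≤ℤ b → x ≤ℤ y
scaled-≤ p q {x} {y} px≡qa py≡qb a≤b =
  *-cancelˡ-≤-pos x y p (subst₂ _≤ℤ_ (sym px≡qa) (sym py≡qb) (*-monoˡ-≤-nonNeg q a≤b))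

-- For any b and t ≥ 0: g_b(t+2) ≥ 0 forces b ≥ (t+2)² > t², hence g_b(t) ≥ 0.
cubic-nonneg-descends : ∀ b t → 0ℤ ≤ℤ cubic b (+ 2 + + t) → 0ℤ ≤ℤ cubic b (+ t)
cubic-nonneg-descends b t 0≤g =
  nonNeg-* (0≤+ t) (subst (0ℤ ≤ℤ_) (sym (gap b (+ t))) (nonNeg-+ b≥u² (0≤+ (4 ℕ* suc t))))
  where
  b≥u² : 0ℤ ≤ℤ b - (+ 2 + + t) * (+ 2 + + t)
  b≥u² = positive-factor (+ 2 + + t) _ 0≤g
  gap : ∀ b T → b - T * T ≡ (b - (+ 2 + T) * (+ 2 + T)) + + 4 * (+ 1 + T)
  gap = solve-∀

-- For any b and t ≥ 0: g_b(t+2) ≤ 0 forces b ≤ (t+2)², and then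
-- g_b(t) - g_b(t+2) = 2((t+2)² - b) + 4t(t+1) ≥ 0.
cubic-nonpos-rises : ∀ b t → cubic b (+ 2 + + t) ≤ℤ 0ℤ → cubic b (+ 2 + + t) ≤ℤ cubic b (+ t)
cubic-nonpos-rises b t g≤0 = 0≤i-j⇒j≤i (subst (0ℤ ≤ℤ_) (sym (difference b (+ t)))
  (nonNeg-+ (nonNeg-* (0≤+ 2) b≤u²) (nonNeg-* (0≤+ 4) (nonNeg-* (0≤+ t) (0≤+ (suc t))))))
  where
  negate : ∀ b u → - (u * (b - u * u)) ≡ u * (u * u - b)
  negate = solve-∀
  b≤u² : 0ℤ ≤ℤ (+ 2 + + t) * (+ 2 + + t) - b
  b≤u² = positive-factor (+ 2 + + t) _ (subst (0ℤ ≤ℤ_) (negate b (+ 2 + + t)) (neg-mono-≤ g≤0))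
  difference : ∀ b T → T * (b - T * T) - (+ 2 + T) * (b - (+ 2 + T) * (+ 2 + T))
                       ≡ + 2 * ((+ 2 + T) * (+ 2 + T) - b) + + 4 * (T * (+ 1 + T))
  difference = solve-∀

-- For n = 2k + t, the coefficients at i = k and i = k+1 are positive multiples
-- of g_{n+4}(t+2) and g_{n+4}(t); the two cubic facts transfer to them.
consecutive-coefficients : ∀ n k t → k ℕ* 2 ℕ+ t ≡ n →
  let Cₖ = C (3 ℕ+ n) n (+ k); Cₖ₊₁ = C (3 ℕ+ n) n (+ k + 1ℤ) in
  (Cₖ ≤ℤ 0ℤ → Cₖ ≤ℤ Cₖ₊₁) × (0ℤ ≤ℤ Cₖ → 0ℤ ≤ℤ Cₖ₊₁)
consecutive-coefficients n k t refl =
  (λ Cₖ≤0 → scaled-≤ (+ 48) (scale n) atₖ atₖ₊₁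
              (cubic-nonpos-rises b t (scaled-≤ (scale n) (+ 48) (sym atₖ) scale·0 Cₖ≤0)))
  , (λ 0≤Cₖ → scaled-≤ (+ 48) (scale n) (sym scale·0) atₖ₊₁
              (cubic-nonneg-descends b t (scaled-≤ (scale n) (+ 48) scale·0 (sym atₖ) 0≤Cₖ)))
  where
  b = + 4 + + n
  n≡2k+t : + n ≡ + k * + 2 + + t
  n≡2k+t = cong (_+ + t) (pos-* k 2)
  offsetₖ : ∀ K T → + 2 + (K * + 2 + T) - + 2 * K ≡ + 2 + T
  offsetₖ = solve-∀
  offsetₖ₊₁ : ∀ K T → + 2 + (K * + 2 + T) - + 2 * (K + 1ℤ) ≡ T
  offsetₖ₊₁ = solve-∀
  uₖ : + 2 + + n - + 2 * + k ≡ + 2 + + t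
  uₖ = trans (cong (λ N → + 2 + N - + 2 * + k) n≡2k+t) (offsetₖ (+ k) (+ t))
  uₖ₊₁ : + 2 + + n - + 2 * (+ k + 1ℤ) ≡ + t
  uₖ₊₁ = trans (cong (λ N → + 2 + N - + 2 * (+ k + 1ℤ)) n≡2k+t) (offsetₖ₊₁ (+ k) (+ t))
  atₖ : + 48 * C (3 ℕ+ n) n (+ k) ≡ scale n * cubic b (+ 2 + + t)
  atₖ = trans (C-formula n (+ k)) (cong (λ u → scale n * cubic b u) uₖ)
  atₖ₊₁ : + 48 * C (3 ℕ+ n) n (+ k + 1ℤ) ≡ scale n * cubic b (+ t)
  atₖ₊₁ = trans (C-formula n (+ k + 1ℤ)) (cong (λ u → scale n * cubic b u) uₖ₊₁)
  scale·0 : scale n * 0ℤ ≡ + 48 * 0ℤ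
  scale·0 = *-zeroʳ (scale n)

half-bound : ∀ n k → k ≤ (4 ℕ+ n) / 2 ∸ 2 → k ℕ* 2 ≤ n
half-bound n k k≤ =
  -- k·2 ≤ (q - 2)·2 = q·2 - 4 ≤ (n + 4) - 4, where q = ⌊(n+4)/2⌋
  ℕ.≤-trans (ℕ.*-monoˡ-≤ 2 k≤)
    (subst (_≤ n) (sym (ℕ.*-distribʳ-∸ 2 q 2)) (ℕ.∸-monoˡ-≤ 4 (m/n*n≤m (4 ℕ+ n) 2)))
  where
  q = (4 ℕ+ n) / 2

lemma2p2 : (d k : ℕ) → 7 ≤ d → k ≤ (suc d / 2) ∸ 2 →
    ((C d (d ∸ 3) (+ k) ≤ℤ 0ℤ → C d (d ∸ 3) (+ k) ≤ℤ C d (d ∸ 3) (+ k + 1ℤ))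
    × (0ℤ ≤ℤ C d (d ∸ 3) (+ k) → 0ℤ ≤ℤ C d (d ∸ 3) (+ k + 1ℤ)))
lemma2p2 (suc (suc (suc n))) k (s≤s (s≤s (s≤s _))) k≤ =
  consecutive-coefficients n k (n ∸ k ℕ* 2) (ℕ.m+[n∸m]≡n (half-bound n k k≤))
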